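{- There exist digraphs $F_1, F_2, \dots$ such that: (i) $\vec{\chi}(F_n) \to \infty$ as $n \to \infty$; (ii) for every $n \geq 1$ and every $v \in V(F_n)$, the neighbourhood $N(v)$ of $v$ in $F_n$ can be partitioned into three sets each inducing a tournament; and (iii) for every $n \geq 1$, the in-triangle $IT$ is not a subgraph of $F_n$.
   Context: All digraphs are finite, loopless, and between any two distinct vertices at most one of the two possible arcs is present. The dichromatic number $\vec{\chi}(D)$ is the least $k$ such that $V(D)$ can be partitioned into $k$ sets each inducing an acyclic subdigraph. $N(v)$ is the set of vertices $u\neq v$ with $uv$ or $vu$ an arc. A tournament is a digraph in which every two distinct vertices are joined by exactly one arc. The in-triangle $IT$ is the digraph on vertices $a,b,c,d$ with arcs $ab, bc, ca, ad, bd, cd$. -}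

module Defs where

open import Data.Nat using (ℕ; suc; _≤_)
open import Data.Fin using (Fin; zero; suc; inject₁; fromℕ)
open import Data.Bool using (Bool; true; false; T)
open import Data.Product using (Σ; ∃; _×_; _,_)
open import Relation.Binary.PropositionalEquality using (_≡_; _≢_)
open import Relation.Nullary using (¬_)
open import Function.Definitions using (Injective)
open import Data.Sum using (_⊎_)

record Digraph : Set where
  field
    size      : ℕ
    arc       : Fin size → Fin size → Bool
    loopless  : ∀ v → arc v v ≡ false
    oriented  : ∀ u v → arc u v ≡ true → arc v u ≡ false
open Digraph public

V : Digraph → Set
V D = Fin (size D)

Arc : (D : Digraph) → V D → V D → Set
Arc D u v = T (arc D u v)

Adj : (D : Digraph) → V D → V D → Set
Adj D u v = Arc D u v ⊎ Arc D v u

-- a directed cycle of length m+1: distinct vertices f 0, …, f m with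
-- arcs f i → f (i+1) and f m → f 0
record Cycle (D : Digraph) (m : ℕ) : Set where
  field
    vtx    : Fin (suc m) → V D
    inj    : Injective _≡_ _≡_ vtx
    step   : ∀ (i : Fin m) → Arc D (vtx (inject₁ i)) (vtx (suc i))
    close  : Arc D (vtx (fromℕ m)) (vtx zero)
open Cycle public

-- a colouring c : V D → Fin k is acyclic if every colour class induces an
-- acyclic subdigraph, i.e. no directed cycle is monochromatic
AcyclicColouring : (D : Digraph) (k : ℕ) → (V D → Fin k) → Set
AcyclicColouring D k c =
  ∀ (m : ℕ) (C : Cycle D m) → ¬ (∀ i j → c (vtx C i) ≡ c (vtx C j))

DiColourable : Digraph → ℕ → Set
DiColourable D k = Σ (V D → Fin k) (AcyclicColouring D k)

DichromaticToInfinity : (ℕ → Digraph) → Set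
DichromaticToInfinity F = ∀ (k : ℕ) → ∃ λ N → ∀ n → N ≤ n → ¬ DiColourable (F n) k

NbhdThreeTournaments : (D : Digraph) → V D → Set
NbhdThreeTournaments D v =
  Σ (V D → Fin 3) λ p →
    ∀ u w → Adj D u v → Adj D w v → u ≢ w → p u ≡ p w → Adj D u w

ITa ITb ITc ITd : Fin 4
ITa = zero
ITb = suc zero
ITc = suc (suc zero)
ITd = suc (suc (suc zero))

ContainsIT : Digraph → Set
ContainsIT D =
  Σ (Fin 4 → V D) λ φ → Injective _≡_ _≡_ φ ×
    (Arc D (φ ITa) (φ ITb) × Arc D (φ ITb) (φ ITc) × Arc D (φ ITc) (φ ITa) ×
     Arc D (φ ITa) (φ ITd) × Arc D (φ ITb) (φ ITd) × Arc D (φ ITc) (φ ITd))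

-- F n has a vertex for each pair i < j below n, two pairs being adjacent exactly when they share an
-- element, with (i , k) → (i , j), (j , k) → (i , k) and (i , j) → (j , k) for i < j < k. For x < y < z
-- the pairs (x , y), (y , z), (x , z) form a directed triangle, so an acyclic k-colouring of F n is a
-- k-colouring of the edges of K_n without monochromatic triangles, which Ramsey's theorem forbids for
-- large n. A neighbour of (a , b) contains a or b, and pairs sharing an element are adjacent, so the
-- pairs through a and the remaining neighbours (all through b) are two tournaments. Finally, the
-- in-neighbourhood of every vertex carries a ranking that strictly drops along its arcs, so it contains
-- no directed triangle, which is exactly the absence of IT.
module Submission where

open import Defs

open import Data.Bool using (true; false; T)
open import Data.Unit using (tt)
open import Data.Empty using (⊥; ⊥-elim)
open import Data.Fin using (Fin; zero; suc; toℕ; combine; remQuot)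
open import Data.Fin.Properties
  using (<-isStrictTotalOrder; toℕ<n; toℕ-injective; remQuot-combine; combine-remQuot)
open import Data.List using (List; []; _∷_; length; filter; allFin)
open import Data.List.Properties using (length-tabulate)
open import Data.List.Membership.Propositional using (find)
open import Data.List.Relation.Unary.All as All using (All; []; _∷_)
open import Data.List.Relation.Unary.All.Properties using (all-filter; ¬Any⇒All¬)
  renaming (filter⁺ to All-filter⁺)
open import Data.List.Relation.Unary.AllPairs as AllPairs using (AllPairs; []; _∷_)
open import Data.List.Relation.Unary.AllPairs.Properties using (tabulate⁺-<)
open import Data.List.Relation.Unary.Any using (any?)
open import Data.List.Relation.Binary.Sublist.Propositional
  using (_⊆_; []; _∷_; _∷ʳ_; ⊆-trans; from∈)
open import Data.List.Relation.Binary.Sublist.Propositional.Properties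
  using (All-resp-⊆; filter-⊆)
open import Data.Nat as ℕ using (ℕ; zero; suc; _+_; _*_; _<_; s≤s)
import Data.Nat.Properties as ℕₚ
open import Data.Nat.Properties
  using (+-suc; +-cancelˡ-<; +-monoˡ-≤; ≤∧≢⇒<; ≮⇒≥; m<n⇒m<1+n; n<1+n; ≤-pred)
  renaming (module ≤-Reasoning to ℕ-Reasoning)
open import Data.Product using (Σ; ∃; ∃₂; _×_; _,_; proj₁; proj₂; uncurry)
open import Data.Product.Relation.Binary.Lex.Strict using (×-Lex; ×-transitive; ×-irreflexive)
open import Data.Sum as Sum using (_⊎_; inj₁; inj₂)
open import Function using (id; _∘_)
open import Function.Definitions using (Injective)
open import Level using (0ℓ)
open import Relation.Binary using (Rel; Decidable; IsStrictTotalOrder; tri<; tri≈; tri>)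
open import Relation.Binary.PropositionalEquality
  using (_≡_; _≢_; refl; sym; trans; cong; subst; subst₂; isEquivalence; module ≡-Reasoning)
open import Relation.Nullary using (¬_; Dec; yes; no; does)
open import Relation.Nullary.Decidable
  using (⌊_⌋; map′; _×-dec_; _⊎-dec_; isYes≗does; dec-false; toWitness; fromWitness)
open import Relation.Unary.Properties using (∁?)
import Relation.Unary as U

private
  variable
    A : Set

AllPairs-resp-⊆ : {R : A → A → Set} {xs ys : List A} → xs ⊆ ys → AllPairs R ys → AllPairs R xs
AllPairs-resp-⊆ []         []         = []
AllPairs-resp-⊆ (_ ∷ʳ τ)   (_ ∷ pys)  = AllPairs-resp-⊆ τ pys
AllPairs-resp-⊆ (refl ∷ τ) (py ∷ pys) = All-resp-⊆ τ py ∷ AllPairs-resp-⊆ τ pys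

sorted-triple : {_<_ : Rel A 0ℓ} {xs : List A} {x y z : A} →
                AllPairs _<_ xs → (x ∷ y ∷ z ∷ []) ⊆ xs → x < y × y < z
sorted-triple sorted xyz⊆xs with AllPairs-resp-⊆ xyz⊆xs sorted
... | (x<y ∷ _) ∷ (y<z ∷ []) ∷ [] ∷ [] = x<y , y<z

length-filter-∁ : {P : A → Set} (P? : U.Decidable P) (xs : List A) →
                  length (filter P? xs) + length (filter (∁? P?) xs) ≡ length xs
length-filter-∁ P? []       = refl
length-filter-∁ P? (x ∷ xs) with does (P? x)
... | true  = cong suc (length-filter-∁ P? xs)
... | false = trans (+-suc _ _) (cong suc (length-filter-∁ P? xs))

pigeonhole : (f : A → ℕ) (k a : ℕ) {xs : List A} → All (λ x → f x < k) xs → k * a < length xs →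
             ∃₂ λ j ys → j < k × ys ⊆ xs × All (λ y → f y ≡ j) ys × a < length ys
pigeonhole f zero    a {[]}    []       ()
pigeonhole f zero    a {_ ∷ _} (() ∷ _) _
pigeonhole f (suc k) a {xs} bounded long with a ℕ.<? length (filter (λ x → f x ℕ.≟ k) xs)
... | yes many = k , _ , n<1+n k , filter-⊆ _ xs , all-filter _ xs , many
... | no few =
  let j , ys , j<k , ys⊆others , fys≡j , long′ = pigeonhole f k a others-bounded others-long
  in  j , ys , m<n⇒m<1+n j<k , ⊆-trans ys⊆others (filter-⊆ _ xs) , fys≡j , long′
  where
  open ℕ-Reasoning
  colourK? = λ x → f x ℕ.≟ k
  others = filter (∁? colourK?) xs
  others-bounded : All (λ x → f x < k) others
  others-bounded = All.zipWith (λ (fx<1+k , fx≢k) → ≤∧≢⇒< (≤-pred fx<1+k) fx≢k)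
                               (All-filter⁺ (∁? colourK?) bounded , all-filter (∁? colourK?) xs)
  others-long : k * a < length others
  others-long = +-cancelˡ-< a _ _ (begin-strict
    a + k * a                                  <⟨ long ⟩
    length xs                                  ≡⟨ sym (length-filter-∁ colourK? xs) ⟩
    length (filter colourK? xs) + length others ≤⟨ +-monoˡ-≤ _ (≮⇒≥ few) ⟩
    a + length others                          ∎)

pair-or-AllPairs¬ : {R : A → A → Set} → Decidable R → (xs : List A) →
                    (∃₂ λ x y → (x ∷ y ∷ []) ⊆ xs × R x y) ⊎ AllPairs (λ x y → ¬ R x y) xs
pair-or-AllPairs¬ R? []       = inj₂ []
pair-or-AllPairs¬ R? (x ∷ xs) with any? (R? x) xs
... | yes hit = let y , y∈xs , Rxy = find hit in inj₁ (x , y , refl ∷ from∈ y∈xs , Rxy)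
... | no miss with pair-or-AllPairs¬ R? xs
...   | inj₁ (y , z , yz⊆xs , Ryz) = inj₁ (y , z , x ∷ʳ yz⊆xs , Ryz)
...   | inj₂ ¬R-pairs               = inj₂ (¬Any⇒All¬ xs miss ∷ ¬R-pairs)

merge : ℕ → ℕ → ℕ → ℕ
merge k j c with c ℕ.≟ k
... | yes _ = j
... | no  _ = c

merge-< : ∀ {k j c} → j < suc k → c < suc k → c ≢ j → merge k j c < k
merge-< {k} {j} {c} j<1+k c<1+k c≢j with c ℕ.≟ k
... | yes refl = ≤∧≢⇒< (≤-pred j<1+k) (λ j≡c → c≢j (sym j≡c))
... | no  c≢k  = ≤∧≢⇒< (≤-pred c<1+k) c≢k

merge-injective : ∀ {k j c d} → c ≢ j → d ≢ j → merge k j c ≡ merge k j d → c ≡ d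
merge-injective {k} {j} {c} {d} c≢j d≢j e with c ℕ.≟ k | d ℕ.≟ k
... | yes refl | yes refl = refl
... | yes _    | no  _    = ⊥-elim (d≢j (sym e))
... | no  _    | yes _    = ⊥-elim (c≢j e)
... | no  _    | no  _    = e

ramseyBound : ℕ → ℕ
ramseyBound zero    = 1
ramseyBound (suc k) = suc (suc k * ramseyBound k)

MonochromaticTriangle : (A → A → ℕ) → List A → Set
MonochromaticTriangle col xs =
  ∃ λ x → ∃ λ y → ∃ λ z → (x ∷ y ∷ z ∷ []) ⊆ xs × col x y ≡ col y z × col x y ≡ col x z

module _ {col : A → A → ℕ} where

  monochromatic-resp-⊆ : {xs ys : List A} → xs ⊆ ys →
                         MonochromaticTriangle col xs → MonochromaticTriangle col ys
  monochromatic-resp-⊆ τ (x , y , z , xyz⊆xs , e₁ , e₂) = x , y , z , ⊆-trans xyz⊆xs τ , e₁ , e₂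

  apex-triangle : ∀ {v j x y ys} → All (λ y → col v y ≡ j) ys → (x ∷ y ∷ []) ⊆ ys → col x y ≡ j →
                  MonochromaticTriangle col (v ∷ ys)
  apex-triangle v-ys≡j xy⊆ys xy≡j with All-resp-⊆ xy⊆ys v-ys≡j
  ... | vx≡j ∷ vy≡j ∷ [] = _ , _ , _ , refl ∷ xy⊆ys , trans vx≡j (sym xy≡j) , trans vx≡j (sym vy≡j)

  unmerge-triangle : ∀ {k j ys} → AllPairs (λ x y → col x y ≢ j) ys →
                     MonochromaticTriangle (λ x y → merge k j (col x y)) ys →
                     MonochromaticTriangle col ys
  unmerge-triangle avoid (x , y , z , xyz⊆ys , e₁ , e₂) with AllPairs-resp-⊆ xyz⊆ys avoid
  ... | (xy≢j ∷ xz≢j ∷ []) ∷ (yz≢j ∷ []) ∷ [] ∷ [] =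
    x , y , z , xyz⊆ys , merge-injective xy≢j yz≢j e₁ , merge-injective xy≢j xz≢j e₂

-- By pigeonhole, more than ramseyBound k of the later elements see the first one v in a single colour j;
-- a pair of colour j among them closes a triangle at v, otherwise merging colour k into j leaves k colours.
ramsey-triangle : ∀ k (col : A → A → ℕ) (xs : List A) → AllPairs (λ x y → col x y < k) xs →
                  ramseyBound k < length xs → MonochromaticTriangle col xs
ramsey-triangle zero    col (x ∷ y ∷ xs) ((() ∷ _) ∷ _) _
ramsey-triangle zero    col (x ∷ [])     _              (s≤s ())
ramsey-triangle (suc k) col (v ∷ xs) (v-bounded ∷ bounded) (s≤s long)
  with j , ys , j<1+k , ys⊆xs , v-ys≡j , long′ ← pigeonhole (col v) (suc k) (ramseyBound k) v-bounded long
  with pair-or-AllPairs¬ (λ x y → col x y ℕ.≟ j) ys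
... | inj₁ (x , y , xy⊆ys , xy≡j) =
  monochromatic-resp-⊆ (refl ∷ ys⊆xs) (apex-triangle v-ys≡j xy⊆ys xy≡j)
... | inj₂ avoid = monochromatic-resp-⊆ (v ∷ʳ ys⊆xs)
  (unmerge-triangle avoid (ramsey-triangle k (λ x y → merge k j (col x y)) ys merged-bounded long′))
  where
  merged-bounded : AllPairs (λ x y → merge k j (col x y) < k) ys
  merged-bounded = AllPairs.zipWith (λ (c<1+k , c≢j) → merge-< j<1+k c<1+k c≢j)
                                    (AllPairs-resp-⊆ ys⊆xs bounded , avoid)

module ShiftRelation {A : Set} {_<_ : Rel A 0ℓ} (sto : IsStrictTotalOrder _≡_ _<_) where

  open IsStrictTotalOrder sto using (irrefl; compare; _≟_; _<?_)
    renaming (trans to <-trans)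

  infix 4 _⇒_ _⇒?_ _∈ₚ_

  data _⇒_ : A × A → A × A → Set where
    lower-max : ∀ {i j k} → i < j → j < k → (i , k) ⇒ (i , j)
    lower-min : ∀ {i j k} → i < j → j < k → (j , k) ⇒ (i , k)
    shift     : ∀ {i j k} → i < j → j < k → (i , j) ⇒ (j , k)

  _⇒?_ : Decidable _⇒_
  (a , b) ⇒? (c , d) = map′ fromCases toCases
    ((a ≟ c ×-dec c <? d ×-dec d <? b) ⊎-dec
     (b ≟ d ×-dec c <? a ×-dec a <? b) ⊎-dec
     (b ≟ c ×-dec a <? b ×-dec c <? d))
    where
    fromCases : _ → (a , b) ⇒ (c , d)
    fromCases (inj₁ (refl , c<d , d<b))        = lower-max c<d d<b
    fromCases (inj₂ (inj₁ (refl , c<a , a<b))) = lower-min c<a a<b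
    fromCases (inj₂ (inj₂ (refl , a<b , c<d))) = shift a<b c<d
    toCases : (a , b) ⇒ (c , d) → _
    toCases (lower-max c<d d<b) = inj₁ (refl , c<d , d<b)
    toCases (lower-min c<a a<b) = inj₂ (inj₁ (refl , c<a , a<b))
    toCases (shift a<b c<d)     = inj₂ (inj₂ (refl , a<b , c<d))

  <-irrefl : ∀ {x} → ¬ x < x
  <-irrefl = irrefl refl

  ⇒-irrefl : ∀ {p} → ¬ p ⇒ p
  ⇒-irrefl (lower-max _ j<k) = <-irrefl j<k
  ⇒-irrefl (lower-min i<j _) = <-irrefl i<j
  ⇒-irrefl (shift i<j _)     = <-irrefl i<j

  ⇒-asym : ∀ {p q} → p ⇒ q → ¬ q ⇒ p
  ⇒-asym (lower-max _ j<k) (lower-max _ k<j) = <-irrefl (<-trans j<k k<j)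
  ⇒-asym (lower-max _ j<k) (lower-min _ _)   = <-irrefl j<k
  ⇒-asym (lower-max i<j _) (shift _ _)       = <-irrefl i<j
  ⇒-asym (lower-min i<j _) (lower-max _ _)   = <-irrefl i<j
  ⇒-asym (lower-min i<j _) (lower-min j<i _) = <-irrefl (<-trans i<j j<i)
  ⇒-asym (lower-min _ j<k) (shift _ _)       = <-irrefl j<k
  ⇒-asym (shift i<j _)     (lower-max _ _)   = <-irrefl i<j
  ⇒-asym (shift _ j<k)     (lower-min _ _)   = <-irrefl j<k
  ⇒-asym (shift i<j j<k)   (shift _ _)       = <-irrefl (<-trans i<j j<k)

  Ordered : A × A → Set
  Ordered (a , b) = a < b

  ⇒-ordered : ∀ {p q} → p ⇒ q → Ordered p × Ordered q
  ⇒-ordered (lower-max i<j j<k) = <-trans i<j j<k , i<j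
  ⇒-ordered (lower-min i<j j<k) = j<k , <-trans i<j j<k
  ⇒-ordered (shift i<j j<k)     = i<j , j<k

  Adjacent : A × A → A × A → Set
  Adjacent p q = p ⇒ q ⊎ q ⇒ p

  adjacent-ordered : ∀ {p q} → Adjacent p q → Ordered p × Ordered q
  adjacent-ordered (inj₁ p⇒q) = ⇒-ordered p⇒q
  adjacent-ordered (inj₂ q⇒p) = let q< , p< = ⇒-ordered q⇒p in p< , q<

  _∈ₚ_ : A → A × A → Set
  x ∈ₚ (a , b) = x ≡ a ⊎ x ≡ b

  _∈ₚ?_ : Decidable _∈ₚ_
  x ∈ₚ? (a , b) = x ≟ a ⊎-dec x ≟ b

  adjacent-meets : ∀ {u a b} → Adjacent u (a , b) → a ∈ₚ u ⊎ b ∈ₚ u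
  adjacent-meets (inj₁ (lower-max _ _)) = inj₁ (inj₁ refl)
  adjacent-meets (inj₁ (lower-min _ _)) = inj₂ (inj₂ refl)
  adjacent-meets (inj₁ (shift _ _))     = inj₁ (inj₂ refl)
  adjacent-meets (inj₂ (lower-max _ _)) = inj₁ (inj₁ refl)
  adjacent-meets (inj₂ (lower-min _ _)) = inj₂ (inj₂ refl)
  adjacent-meets (inj₂ (shift _ _))     = inj₂ (inj₁ refl)

  meeting⇒adjacent : ∀ {p q x} → Ordered p → Ordered q → p ≢ q → x ∈ₚ p → x ∈ₚ q → Adjacent p q
  meeting⇒adjacent {a , b} {c , d} a<b c<d p≢q (inj₁ refl) (inj₁ refl) with compare b d
  ... | tri< b<d _ _ = inj₂ (lower-max a<b b<d)
  ... | tri≈ _ refl _ = ⊥-elim (p≢q refl)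
  ... | tri> _ _ d<b = inj₁ (lower-max c<d d<b)
  meeting⇒adjacent a<b c<d _ (inj₁ refl) (inj₂ refl) = inj₂ (shift c<d a<b)
  meeting⇒adjacent a<b c<d _ (inj₂ refl) (inj₁ refl) = inj₁ (shift a<b c<d)
  meeting⇒adjacent {a , b} {c , d} a<b c<d p≢q (inj₂ refl) (inj₂ refl) with compare a c
  ... | tri< a<c _ _ = inj₂ (lower-min a<c c<d)
  ... | tri≈ _ refl _ = ⊥-elim (p≢q refl)
  ... | tri> _ _ c<a = inj₁ (lower-min c<a a<b)

  neighbours-meeting⇒adjacent : ∀ {u w v x} → Adjacent u v → Adjacent w v → u ≢ w →
                                x ∈ₚ u → x ∈ₚ w → Adjacent u w
  neighbours-meeting⇒adjacent uv wv =
    meeting⇒adjacent (proj₁ (adjacent-ordered uv)) (proj₁ (adjacent-ordered wv))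

  adjacent-meets-max : ∀ {u a b} → Adjacent u (a , b) → ¬ a ∈ₚ u → b ∈ₚ u
  adjacent-meets-max uv a∉u = Sum.[ (λ a∈u → ⊥-elim (a∉u a∈u)) , id ] (adjacent-meets uv)

  same-side-neighbours-adjacent : ∀ {u w a b} → Adjacent u (a , b) → Adjacent w (a , b) → u ≢ w →
                                  a ∈ₚ u × a ∈ₚ w ⊎ ¬ a ∈ₚ u × ¬ a ∈ₚ w → Adjacent u w
  same-side-neighbours-adjacent uv wv u≢w (inj₁ (a∈u , a∈w)) =
    neighbours-meeting⇒adjacent uv wv u≢w a∈u a∈w
  same-side-neighbours-adjacent uv wv u≢w (inj₂ (a∉u , a∉w)) =
    neighbours-meeting⇒adjacent uv wv u≢w (adjacent-meets-max uv a∉u) (adjacent-meets-max wv a∉w)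

  _≺_ : Rel (ℕ × A) 0ℓ
  _≺_ = ×-Lex _≡_ ℕ._<_ _<_

  ≺-trans : ∀ {r s t} → r ≺ s → s ≺ t → r ≺ t
  ≺-trans = ×-transitive {_≈₁_ = _≡_} {_<₁_ = ℕ._<_} {_<₂_ = _<_}
                         isEquivalence ℕₚ.<-resp₂-≡ ℕₚ.<-trans <-trans

  ≺-irrefl : ∀ {r} → ¬ r ≺ r
  ≺-irrefl = ×-irreflexive {_≈₁_ = _≡_} {_<₁_ = ℕ._<_} {_≈₂_ = _≡_} {_<₂_ = _<_}
                           ℕₚ.<-irrefl irrefl (refl , refl)

  -- The in-neighbours of d = (p , q) are the pairs (x , q) with p < x < q, (p , y) with q < y, and
  -- (x , p) with x < p. Arcs among them stay within a kind and lower its moving end, or go from the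
  -- third kind to the second; so rank, ordered lexicographically, drops along every such arc.
  rank : ∀ {p d} → p ⇒ d → ℕ × A
  rank (lower-min {j = j} _ _) = 0 , j
  rank (lower-max {k = k} _ _) = 1 , k
  rank (shift {i = i} _ _)     = 2 , i

  rank-decreasing : ∀ {p q d} (p⇒d : p ⇒ d) (q⇒d : q ⇒ d) → p ⇒ q → rank q⇒d ≺ rank p⇒d
  rank-decreasing (lower-max _ _) (lower-max _ _) (lower-max _ c₂) = inj₂ (refl , c₂)
  rank-decreasing (lower-max _ _) (lower-max _ _) (lower-min c₁ _) = ⊥-elim (<-irrefl c₁)
  rank-decreasing (lower-max a₁ a₂) (lower-max _ _) (shift _ _)    = ⊥-elim (<-irrefl (<-trans a₁ a₂))
  rank-decreasing (lower-max _ _) (lower-min b₁ _) (lower-max _ _) = ⊥-elim (<-irrefl b₁)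
  rank-decreasing (lower-max _ a₂) (lower-min _ _) (lower-min _ _) = ⊥-elim (<-irrefl a₂)
  rank-decreasing (lower-max _ a₂) (lower-min _ b₂) (shift _ _)    = ⊥-elim (<-irrefl (<-trans a₂ b₂))
  rank-decreasing (lower-max _ _) (shift b₁ _) (lower-max _ _)     = ⊥-elim (<-irrefl b₁)
  rank-decreasing (lower-max a₁ a₂) (shift _ _) (lower-min _ _)    = ⊥-elim (<-irrefl (<-trans a₁ a₂))
  rank-decreasing (lower-max a₁ a₂) (shift b₁ _) (shift _ _)       = ⊥-elim (<-irrefl (<-trans b₁ (<-trans a₁ a₂)))
  rank-decreasing (lower-min a₁ _) (lower-max _ _) (lower-max _ _) = ⊥-elim (<-irrefl a₁)
  rank-decreasing (lower-min _ _) (lower-max _ b₂) (lower-min _ _) = ⊥-elim (<-irrefl b₂)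
  rank-decreasing (lower-min _ _) (lower-max b₁ _) (shift _ _)     = ⊥-elim (<-irrefl b₁)
  rank-decreasing (lower-min _ _) (lower-min _ _) (lower-max _ c₂) = ⊥-elim (<-irrefl c₂)
  rank-decreasing (lower-min _ _) (lower-min _ _) (lower-min c₁ _) = inj₂ (refl , c₁)
  rank-decreasing (lower-min _ _) (lower-min _ b₂) (shift _ _)     = ⊥-elim (<-irrefl b₂)
  rank-decreasing (lower-min a₁ _) (shift b₁ _) (lower-max _ _)    = ⊥-elim (<-irrefl (<-trans a₁ b₁))
  rank-decreasing (lower-min _ _) (shift _ b₂) (lower-min _ _)     = ⊥-elim (<-irrefl b₂)
  rank-decreasing (lower-min _ _) (shift b₁ b₂) (shift _ _)        = ⊥-elim (<-irrefl (<-trans b₁ b₂))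
  rank-decreasing (shift _ _) (lower-max _ _) _                    = inj₁ (ℕₚ.n<1+n 1)
  rank-decreasing (shift a₁ _) (lower-min b₁ _) (lower-max _ _)    = ⊥-elim (<-irrefl (<-trans a₁ b₁))
  rank-decreasing (shift _ a₂) (lower-min _ _) (lower-min _ _)     = ⊥-elim (<-irrefl a₂)
  rank-decreasing (shift _ _) (lower-min b₁ _) (shift _ _)         = ⊥-elim (<-irrefl b₁)
  rank-decreasing (shift _ _) (shift _ _) (lower-max _ c₂)         = ⊥-elim (<-irrefl c₂)
  rank-decreasing (shift _ _) (shift _ _) (lower-min c₁ _)         = inj₂ (refl , c₁)
  rank-decreasing (shift _ _) (shift b₁ _) (shift _ _)             = ⊥-elim (<-irrefl b₁)

  in-triangle-free : ∀ {a b c d} → a ⇒ b → b ⇒ c → c ⇒ a → a ⇒ d → b ⇒ d → c ⇒ d → ⊥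
  in-triangle-free ab bc ca ad bd cd =
    ≺-irrefl (≺-trans (rank-decreasing ad bd ab)
                      (≺-trans (rank-decreasing cd ad ca) (rank-decreasing bd cd bc)))

indicator : {P : Set} → Dec P → Fin 3
indicator (yes _) = zero
indicator (no _)  = suc zero

indicator-agree : {P Q : Set} (P? : Dec P) (Q? : Dec Q) →
                  indicator P? ≡ indicator Q? → P × Q ⊎ ¬ P × ¬ Q
indicator-agree (yes p) (yes q) _ = inj₁ (p , q)
indicator-agree (no ¬p) (no ¬q) _ = inj₂ (¬p , ¬q)

no-loop : (D : Digraph) {v : V D} → ¬ Arc D v v
no-loop D {v} = subst T (loopless D v)

arc-distinct : (D : Digraph) {u v : V D} → Arc D u v → u ≢ v
arc-distinct D {u} uv u≡v = no-loop D (subst (Arc D u) (sym u≡v) uv)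

triangle-cycle : (D : Digraph) {a b c : V D} → Arc D a b → Arc D b c → Arc D c a → Cycle D 2
triangle-cycle D {a} {b} {c} ab bc ca = record
  { vtx = vertex ; inj = vertex-injective ; step = λ { zero → ab ; (suc zero) → bc } ; close = ca }
  where
  vertex : Fin 3 → V D
  vertex zero             = a
  vertex (suc zero)       = b
  vertex (suc (suc zero)) = c
  vertex-injective : Injective _≡_ _≡_ vertex
  vertex-injective {zero}             {zero}             _ = refl
  vertex-injective {suc zero}         {suc zero}         _ = refl
  vertex-injective {suc (suc zero)}   {suc (suc zero)}   _ = refl
  vertex-injective {zero}             {suc zero}         e = ⊥-elim (arc-distinct D ab e)
  vertex-injective {suc zero}         {zero}             e = ⊥-elim (arc-distinct D ab (sym e))
  vertex-injective {suc zero}         {suc (suc zero)}   e = ⊥-elim (arc-distinct D bc e)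
  vertex-injective {suc (suc zero)}   {suc zero}         e = ⊥-elim (arc-distinct D bc (sym e))
  vertex-injective {suc (suc zero)}   {zero}             e = ⊥-elim (arc-distinct D ca e)
  vertex-injective {zero}             {suc (suc zero)}   e = ⊥-elim (arc-distinct D ca (sym e))

acyclic-no-monochromatic-triangle : (D : Digraph) {k : ℕ} (κ : V D → Fin k) → AcyclicColouring D k κ →
                                    {a b c : V D} → Arc D a b → Arc D b c → Arc D c a →
                                    κ a ≡ κ b → κ a ≡ κ c → ⊥
acyclic-no-monochromatic-triangle D κ acyclic {a} ab bc ca κa≡κb κa≡κc =
  acyclic 2 cycle λ i j → trans (colour≡κa i) (sym (colour≡κa j))
  where
  cycle = triangle-cycle D ab bc ca
  colour≡κa : ∀ i → κ (vtx cycle i) ≡ κ a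
  colour≡κa zero             = refl
  colour≡κa (suc zero)       = sym κa≡κb
  colour≡κa (suc (suc zero)) = sym κa≡κc

module _ (n : ℕ) where

  open ShiftRelation (<-isStrictTotalOrder {n})

  -- A vertex u of F n stands for the pair ends u; the pairs (i , j) with j ≤ i are isolated vertices.
  ends : Fin (n * n) → Fin n × Fin n
  ends = remQuot n

  F : Digraph
  F = record
    { size     = n * n
    ; arc      = λ u v → ⌊ ends u ⇒? ends v ⌋
    ; loopless = λ v → trans (isYes≗does _) (dec-false (ends v ⇒? ends v) ⇒-irrefl)
    ; oriented = λ u v uv → trans (isYes≗does _) (dec-false (ends v ⇒? ends u)
                   (⇒-asym (toWitness {a? = ends u ⇒? ends v} (subst T (sym uv) tt))))
    }

  arc⇒ : ∀ {u v} → Arc F u v → ends u ⇒ ends v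
  arc⇒ {u} {v} = toWitness {a? = ends u ⇒? ends v}

  ⇒arc : ∀ {u v} → ends u ⇒ ends v → Arc F u v
  ⇒arc {u} {v} = fromWitness {a? = ends u ⇒? ends v}

  combine⇒arc : ∀ {x y x′ y′} → (x , y) ⇒ (x′ , y′) → Arc F (combine x y) (combine x′ y′)
  combine⇒arc {x} {y} {x′} {y′} =
    ⇒arc ∘ subst₂ _⇒_ (sym (remQuot-combine x y)) (sym (remQuot-combine x′ y′))

  adj⇒ : ∀ {u v} → Adj F u v → Adjacent (ends u) (ends v)
  adj⇒ = Sum.map arc⇒ arc⇒

  ends-injective : ∀ {u w} → ends u ≡ ends w → u ≡ w
  ends-injective {u} {w} e = begin
    u                        ≡⟨ combine-remQuot {n} n u ⟨
    uncurry combine (ends u) ≡⟨ cong (uncurry combine) e ⟩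
    uncurry combine (ends w) ≡⟨ combine-remQuot {n} n w ⟩
    w                        ∎
    where open ≡-Reasoning

  F-neighbourhoods : ∀ v → NbhdThreeTournaments F v
  F-neighbourhoods v = side , same-side⇒adjacent
    where
    side : V F → Fin 3
    side u = indicator (proj₁ (ends v) ∈ₚ? ends u)
    same-side⇒adjacent : ∀ u w → Adj F u v → Adj F w v → u ≢ w → side u ≡ side w → Adj F u w
    same-side⇒adjacent u w uv wv u≢w same = Sum.map ⇒arc ⇒arc
      (same-side-neighbours-adjacent (adj⇒ uv) (adj⇒ wv) (u≢w ∘ ends-injective)
                                     (indicator-agree _ _ same))

  F-in-triangle-free : ¬ ContainsIT F
  F-in-triangle-free (_ , _ , ab , bc , ca , ad , bd , cd) =
    in-triangle-free (arc⇒ ab) (arc⇒ bc) (arc⇒ ca) (arc⇒ ad) (arc⇒ bd) (arc⇒ cd)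

  F-not-colourable : ∀ {k} → ramseyBound k < n → ¬ DiColourable F k
  F-not-colourable {k} big (κ , acyclic) =
    let x , y , z , xyz⊆ , e₁ , e₂ = ramsey-triangle k colour (allFin n) bounded long
        x<y , y<z = sorted-triple (tabulate⁺-< id) xyz⊆
    in  acyclic-no-monochromatic-triangle F κ acyclic
          (combine⇒arc (shift x<y y<z)) (combine⇒arc (lower-min x<y y<z))
          (combine⇒arc (lower-max x<y y<z))
          (toℕ-injective e₁) (toℕ-injective e₂)
    where
    colour : Fin n → Fin n → ℕ
    colour x y = toℕ (κ (combine x y))
    bounded : AllPairs (λ x y → colour x y < k) (allFin n)
    bounded = tabulate⁺-< (λ _ → toℕ<n _)
    long : ramseyBound k < length (allFin n)
    long = subst (ramseyBound k <_) (sym (length-tabulate id)) big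

theorem2p5 : Σ (ℕ → Digraph) λ F →
    DichromaticToInfinity F ×
    (∀ n (v : V (F n)) → NbhdThreeTournaments (F n) v) ×
    (∀ n → ¬ ContainsIT (F n))
theorem2p5 =
  F , (λ k → suc (ramseyBound k) , λ n → F-not-colourable n) , F-neighbourhoods , F-in-triangle-free
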